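{- Let $p,q$ be positive integers and let $x=(x(N))_{N\ge0}$ be a fixed point of a $p$-$q$-block substitution. Let $r$ be a positive integer. Then the sequence $y=(x(rN))_{N\ge0}$ is the image under a coding of a fixed point of some $p$-$q$-block substitution.
   Context: A $p$-$q$-block substitution $\sigma$ on an alphabet $A$ assigns to each word of length $p$ over $A$ a word of length $q$ over $A$; it acts on an infinite sequence $x=x_0x_1\dots$ by $\sigma(x)=z$ where $z_{qk}\dots z_{q(k+1)-1}=\sigma(x_{pk}\dots x_{p(k+1)-1})$ for $k\ge0$. A fixed point of $\sigma$ is a sequence $x$ with $\sigma(x)=x$. A coding is a letter-to-letter map from one alphabet to another, applied letterwise to sequences. -}

module Defs where

open import Data.Nat using (ℕ; _*_; _+_; NonZero)
open import Data.Nat.DivMod using (_/_; _%_; m%n<n)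
open import Data.Fin using (Fin; toℕ; fromℕ<)
open import Data.Vec using (Vec; tabulate; lookup)
open import Relation.Binary.PropositionalEquality using (_≡_)

Seq : Set → Set
Seq A = ℕ → A

BlockSubst : Set → ℕ → ℕ → Set
BlockSubst A p q = Vec A p → Vec A q

block : {A : Set} → Seq A → (p k : ℕ) → Vec A p
block x p k = tabulate (λ i → x (k * p + toℕ i))

apply : {A : Set} {p q : ℕ} .{{_ : NonZero q}} →
        BlockSubst A p q → Seq A → Seq A
apply {p = p} {q = q} σ x n = lookup (σ (block x p (n / q))) (fromℕ< (m%n<n n q))

IsFixedPoint : {A : Set} {p q : ℕ} .{{_ : NonZero q}} →
               BlockSubst A p q → Seq A → Set
IsFixedPoint σ x = ∀ n → apply σ x n ≡ x n

-- Cut x into consecutive blocks of length r and read each block as a single letter over the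
-- alphabet Vec A r ≅ Fin (a ^ r). The K-th run of p such letters is the K-th block of x of length
-- p·r, that is, r consecutive p-blocks of x; since σ fixes x, applying σ to each of them gives the
-- K-th block of x of length q·r, which regroups into q letters. So the r-block sequence of x is
-- fixed by a p-q-block substitution, and x (r N) is the first entry of its N-th letter.
module Submission where

open import Defs
open import Data.Nat using (ℕ; suc; _*_; _+_; _^_; _<_; NonZero)
open import Data.Nat.Properties using (*-comm; +-comm; +-identityʳ)
open import Data.Nat.DivMod
  using (_/_; _%_; m%n<n; m≡m%n+[m/n]*n; m*n/n≡m; m<n⇒m/n≡0; m<n⇒m%n≡m; +-distrib-/-∣ˡ; %-remove-+ˡ)
open import Data.Nat.Divisibility using (divides-refl)
open import Data.Nat.Solver using (module +-*-Solver)
open import Data.Fin using (Fin; zero; toℕ; fromℕ<; combine; remQuot; finToFun; funToFin)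
open import Data.Fin.Properties
  using (toℕ<n; toℕ-fromℕ<; toℕ-injective; toℕ-combine; combine-remQuot; finToFun-funToFin)
open import Data.Vec using (Vec; lookup; tabulate; map; concat; cast)
open import Data.Vec.Properties
  using (lookup∘tabulate; tabulate∘lookup; tabulate-cong; tabulate-∘; lookup-concat;
         map-∘; map-cong; map-id; cast-is-id)
open import Data.Product using (Σ; _×_; _,_; uncurry)
open import Function using (_∘_; id)
open import Relation.Binary.PropositionalEquality
open ≡-Reasoning
open +-*-Solver using (solve; _:=_; _:+_; _:*_)

private
  variable
    A B : Set
    m n p q : ℕ

lookup-extensionality : {xs ys : Vec A n} → (∀ i → lookup xs i ≡ lookup ys i) → xs ≡ ys
lookup-extensionality {xs = xs} {ys} eq = begin
  xs                    ≡⟨ tabulate∘lookup xs ⟨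
  tabulate (lookup xs)  ≡⟨ tabulate-cong eq ⟩
  tabulate (lookup ys)  ≡⟨ tabulate∘lookup ys ⟩
  ys                    ∎

IsBlockFixedPoint : BlockSubst A p q → Seq A → Set
IsBlockFixedPoint {p = p} {q} σ x = ∀ k → σ (block x p k) ≡ block x q k

[kq+j]/q≡k : ∀ k j q .{{_ : NonZero q}} → j < q → (k * q + j) / q ≡ k
[kq+j]/q≡k k j q j<q = begin
  (k * q + j) / q     ≡⟨ +-distrib-/-∣ˡ j (divides-refl k) ⟩
  k * q / q + j / q   ≡⟨ cong₂ _+_ (m*n/n≡m k q) (m<n⇒m/n≡0 j<q) ⟩
  k + 0               ≡⟨ +-identityʳ k ⟩
  k                   ∎

[kq+j]%q≡j : ∀ k j q .{{_ : NonZero q}} → j < q → (k * q + j) % q ≡ j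
[kq+j]%q≡j k j q j<q = trans (%-remove-+ˡ j (divides-refl k)) (m<n⇒m%n≡m j<q)

module _ .{{_ : NonZero q}} {σ : BlockSubst A p q} {x : Seq A} where

  isFixedPoint⇒isBlockFixedPoint : IsFixedPoint σ x → IsBlockFixedPoint σ x
  isFixedPoint⇒isBlockFixedPoint fixed k = lookup-extensionality λ j →
    let n = k * q + toℕ j
        j<q = toℕ<n j
    in begin
      lookup (σ (block x p k)) j
        ≡⟨ cong₂ (λ k′ j′ → lookup (σ (block x p k′)) j′)
                 ([kq+j]/q≡k k (toℕ j) q j<q)
                 (toℕ-injective (trans (toℕ-fromℕ< (m%n<n n q)) ([kq+j]%q≡j k (toℕ j) q j<q))) ⟨
      apply σ x n              ≡⟨ fixed n ⟩
      x n                      ≡⟨ lookup∘tabulate _ j ⟨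
      lookup (block x q k) j   ∎

  isBlockFixedPoint⇒isFixedPoint : IsBlockFixedPoint σ x → IsFixedPoint σ x
  isBlockFixedPoint⇒isFixedPoint fixed n = begin
    apply σ x n                              ≡⟨ cong (λ w → lookup w (fromℕ< (m%n<n n q))) (fixed (n / q)) ⟩
    lookup (block x q (n / q)) (fromℕ< _)    ≡⟨ lookup∘tabulate (λ j → x (n / q * q + toℕ j)) _ ⟩
    x (n / q * q + toℕ (fromℕ< _))           ≡⟨ cong (λ j → x (n / q * q + j)) (toℕ-fromℕ< (m%n<n n q)) ⟩
    x (n / q * q + n % q)                    ≡⟨ cong x (trans (m≡m%n+[m/n]*n n q) (+-comm (n % q) (n / q * q))) ⟨
    x n                                      ∎

block-∘ : (f : A → B) (x : Seq A) (n k : ℕ) → block (f ∘ x) n k ≡ map f (block x n k)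
block-∘ f x n k = tabulate-∘ f _

map-retraction : {f : A → B} {g : B → A} → g ∘ f ≗ id → (v : Vec A n) → map g (map f v) ≡ v
map-retraction {f = f} {g} retract v = trans (sym (map-∘ g f v)) (trans (map-cong retract v) (map-id v))

recode : (A → B) → (B → A) → BlockSubst A p q → BlockSubst B p q
recode encode decode σ = map encode ∘ σ ∘ map decode

recode-isBlockFixedPoint : (encode : A → B) (decode : B → A) → decode ∘ encode ≗ id →
  {σ : BlockSubst A p q} {x : Seq A} →
  IsBlockFixedPoint σ x → IsBlockFixedPoint (recode encode decode σ) (encode ∘ x)
recode-isBlockFixedPoint {p = p} {q} encode decode retract {σ} {x} fixed k = begin
  map encode (σ (map decode (block (encode ∘ x) p k)))    ≡⟨ cong (map encode ∘ σ ∘ map decode) (block-∘ encode x p k) ⟩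
  map encode (σ (map decode (map encode (block x p k))))  ≡⟨ cong (map encode ∘ σ) (map-retraction retract (block x p k)) ⟩
  map encode (σ (block x p k))                            ≡⟨ cong (map encode) (fixed k) ⟩
  map encode (block x q k)                                ≡⟨ block-∘ encode x q k ⟨
  block (encode ∘ x) q k                                  ∎

blocks : (m : ℕ) → Seq A → Seq (Vec A m)
blocks m x = block x m

chunk : (n m : ℕ) → Vec A (n * m) → Vec (Vec A m) n
chunk n m v = tabulate λ i → tabulate λ j → lookup v (combine i j)

concat-chunk : (n m : ℕ) (v : Vec A (n * m)) → concat (chunk n m v) ≡ v
concat-chunk n m v = lookup-extensionality λ s →
  subst (λ s → lookup (concat (chunk n m v)) s ≡ lookup v s) (combine-remQuot {n} m s) (at-combine (remQuot {n} m s))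
  where
  at-combine : ∀ ij → lookup (concat (chunk n m v)) (uncurry combine ij) ≡ lookup v (uncurry combine ij)
  at-combine (i , j) = begin
    lookup (concat (chunk n m v)) (combine i j)         ≡⟨ lookup-concat (chunk n m v) i j ⟩
    lookup (lookup (chunk n m v) i) j                   ≡⟨ cong (λ w → lookup w j) (lookup∘tabulate _ i) ⟩
    lookup (tabulate (λ j → lookup v (combine i j))) j  ≡⟨ lookup∘tabulate _ j ⟩
    lookup v (combine i j)                              ∎

rechunk : Vec (Vec A m) n → Vec (Vec A n) m
rechunk {m = m} {n} = chunk m n ∘ cast (*-comm n m) ∘ concat

lookup-block-combine : (x : Seq A) (K : ℕ) (i : Fin n) (j : Fin m) →
  lookup (block x (n * m) K) (combine i j) ≡ x ((K * n + toℕ i) * m + toℕ j)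
lookup-block-combine {n = n} {m} x K i j = begin
  lookup (block x (n * m) K) (combine i j)  ≡⟨ lookup∘tabulate _ (combine i j) ⟩
  x (K * (n * m) + toℕ (combine i j))       ≡⟨ cong (λ s → x (K * (n * m) + s)) (toℕ-combine i j) ⟩
  x (K * (n * m) + (m * toℕ i + toℕ j))     ≡⟨ cong x (solve 5 (λ K n m i j → K :* (n :* m) :+ (m :* i :+ j) := (K :* n :+ i) :* m :+ j)
                                                            refl K n m (toℕ i) (toℕ j)) ⟩
  x ((K * n + toℕ i) * m + toℕ j)           ∎

chunk-block : (n m : ℕ) (x : Seq A) (K : ℕ) → chunk n m (block x (n * m) K) ≡ block (blocks m x) n K
chunk-block n m x K = tabulate-cong λ i → tabulate-cong λ j → lookup-block-combine x K i j

concat-block : (n m : ℕ) (x : Seq A) (K : ℕ) → concat (block (blocks m x) n K) ≡ block x (n * m) K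
concat-block n m x K = begin
  concat (block (blocks m x) n K)          ≡⟨ cong concat (chunk-block n m x K) ⟨
  concat (chunk n m (block x (n * m) K))   ≡⟨ concat-chunk n m (block x (n * m) K) ⟩
  block x (n * m) K                        ∎

cast-block : (e : n ≡ m) (x : Seq A) (K : ℕ) → cast e (block x n K) ≡ block x m K
cast-block refl x K = cast-is-id refl _

rechunk-block : (n m : ℕ) (x : Seq A) (K : ℕ) → rechunk (block (blocks m x) n K) ≡ block (blocks n x) m K
rechunk-block n m x K = begin
  chunk m n (cast (*-comm n m) (concat (block (blocks m x) n K)))  ≡⟨ cong (chunk m n ∘ cast (*-comm n m)) (concat-block n m x K) ⟩
  chunk m n (cast (*-comm n m) (block x (n * m) K))                ≡⟨ cong (chunk m n) (cast-block (*-comm n m) x K) ⟩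
  chunk m n (block x (m * n) K)                                    ≡⟨ chunk-block m n x K ⟩
  block (blocks n x) m K                                           ∎

higherBlock : (r : ℕ) → BlockSubst A p q → BlockSubst (Vec A r) p q
higherBlock r σ = rechunk ∘ map σ ∘ rechunk

higherBlock-isBlockFixedPoint : {σ : BlockSubst A p q} {x : Seq A} (r : ℕ) →
  IsBlockFixedPoint σ x → IsBlockFixedPoint (higherBlock r σ) (blocks r x)
higherBlock-isBlockFixedPoint {p = p} {q} {σ = σ} {x} r fixed K = begin
  rechunk (map σ (rechunk (block (blocks r x) p K)))  ≡⟨ cong (rechunk ∘ map σ) (rechunk-block p r x K) ⟩
  rechunk (map σ (block (blocks p x) r K))            ≡⟨ cong rechunk map-σ ⟩
  rechunk (block (blocks q x) r K)                    ≡⟨ rechunk-block r q x K ⟩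
  block (blocks r x) q K                              ∎
  where
  map-σ : map σ (block (blocks p x) r K) ≡ block (blocks q x) r K
  map-σ = trans (sym (tabulate-∘ σ _)) (tabulate-cong λ D → fixed (K * r + toℕ D))

vecToFin : {a : ℕ} → Vec (Fin a) n → Fin (a ^ n)
vecToFin = funToFin ∘ lookup

finToVec : {a : ℕ} (n : ℕ) → Fin (a ^ n) → Vec (Fin a) n
finToVec n = tabulate ∘ finToFun

finToVec-vecToFin : {a : ℕ} (v : Vec (Fin a) n) → finToVec n (vecToFin v) ≡ v
finToVec-vecToFin v = trans (tabulate-cong (finToFun-funToFin (lookup v))) (tabulate∘lookup v)

theorem11 : (p q : ℕ) → .{{_ : NonZero p}} → .{{_ : NonZero q}} →
    (a : ℕ) (σ : BlockSubst (Fin a) p q) (x : Seq (Fin a)) →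
    IsFixedPoint σ x →
    (r : ℕ) → .{{_ : NonZero r}} →
    Σ ℕ (λ b → Σ (BlockSubst (Fin b) p q) (λ τ → Σ (Seq (Fin b)) (λ z →
    Σ (Fin b → Fin a) (λ c →
    IsFixedPoint τ z × (∀ N → x (r * N) ≡ c (z N))))))
theorem11 p q a σ x fixed r@(suc _) = a ^ r , τ , z , head , isFixedPoint-z , coding
  where
  τ : BlockSubst (Fin (a ^ r)) p q
  τ = recode vecToFin (finToVec r) (higherBlock r σ)

  z : Seq (Fin (a ^ r))
  z = vecToFin ∘ blocks r x

  head : Fin (a ^ r) → Fin a
  head w = lookup (finToVec r w) zero

  isFixedPoint-z : IsFixedPoint τ z
  isFixedPoint-z = isBlockFixedPoint⇒isFixedPoint {σ = τ}
    (recode-isBlockFixedPoint vecToFin (finToVec r) finToVec-vecToFin {σ = higherBlock r σ} {x = blocks r x}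
      (higherBlock-isBlockFixedPoint {x = x} r (isFixedPoint⇒isBlockFixedPoint {σ = σ} fixed)))

  coding : ∀ N → x (r * N) ≡ head (z N)
  coding N = begin
    x (r * N)                   ≡⟨ cong x (trans (+-identityʳ (N * r)) (*-comm N r)) ⟨
    lookup (blocks r x N) zero  ≡⟨ cong (λ v → lookup v zero) (finToVec-vecToFin (blocks r x N)) ⟨
    head (z N)                  ∎
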